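{- Let $F$ be a frequency array of order $k$ for which an outline array exists, and let $S_1,\dots,S_{k'}$ be a partition of $[k]$ into non-empty sets. Then there exists an outline array corresponding to the frequency array $F^*$ of order $k'$ given by $F^*(i,j)=\sum_{x\in S_i}\sum_{y\in S_j}F(x,y)$ for all $i,j\in[k']$.
   Context: A frequency array $F$ of order $k$ is a $k\times k$ array each of whose cells contains a single non-negative integer. Given a $k\times k$ array $O$ of multisets with elements from $[k]$, let $O(i,j)$ be the multiset in cell $(i,j)$, $O^i_\ell$ the number of copies of symbol $\ell$ in row $i$, and ${}^jO_\ell$ the number of copies of symbol $\ell$ in column $j$ (counted with multiplicity). $O$ is an outline array corresponding to $F$ if for all $i,j,\ell\in[k]$: $|O(i,j)|=F(i,j)$, $O^i_\ell=F(i,\ell)$, and ${}^jO_\ell=F(\ell,j)$. -}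

module Defs where

open import Data.Nat using (ℕ; zero; suc; _+_)
open import Data.Fin using (Fin; zero; suc; _≟_)
open import Data.Product using (∃; Σ; _×_)
open import Relation.Binary.PropositionalEquality using (_≡_)
open import Relation.Nullary using (yes; no)
open import Function.Definitions using (Surjective)

sumFin : ∀ {n} → (Fin n → ℕ) → ℕ
sumFin {zero}  f = 0
sumFin {suc n} f = f zero + sumFin (λ i → f (suc i))

FrequencyArray : ℕ → Set
FrequencyArray k = Fin k → Fin k → ℕ

-- A finite multiset with elements from [k], given by its multiplicity function.
Multiset : ℕ → Set
Multiset k = Fin k → ℕ

∣_∣ₘ : ∀ {k} → Multiset k → ℕ
∣ M ∣ₘ = sumFin M

MultisetArray : ℕ → Set
MultisetArray k = Fin k → Fin k → Multiset k

rowCount : ∀ {k} → MultisetArray k → Fin k → Fin k → ℕ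
rowCount O i ℓ = sumFin (λ j → O i j ℓ)

colCount : ∀ {k} → MultisetArray k → Fin k → Fin k → ℕ
colCount O j ℓ = sumFin (λ i → O i j ℓ)

IsOutlineArray : ∀ {k} → FrequencyArray k → MultisetArray k → Set
IsOutlineArray {k} F O =
  (∀ (i j ℓ : Fin k) → (∣ O i j ∣ₘ ≡ F i j) × (rowCount O i ℓ ≡ F i ℓ) × (colCount O j ℓ ≡ F ℓ j))

HasOutlineArray : ∀ {k} → FrequencyArray k → Set
HasOutlineArray {k} F = ∃ λ (O : MultisetArray k) → IsOutlineArray F O

-- A partition S_1,…,S_{k'} of [k] into non-empty sets, encoded by the block map
-- σ : [k] → [k'] (x ∈ S_{σ x}); non-emptiness of every block = surjectivity.
IsPartitionMap : ∀ {k k'} → (Fin k → Fin k') → Set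
IsPartitionMap σ = Surjective _≡_ _≡_ σ

blockInd : ∀ {k k'} → (Fin k → Fin k') → Fin k' → Fin k → ℕ → ℕ
blockInd σ i x n with σ x ≟ i
... | yes _ = n
... | no  _ = 0

reduceFreq : ∀ {k k'} → (Fin k → Fin k') → FrequencyArray k → FrequencyArray k'
reduceFreq σ F i j =
  sumFin (λ x → blockInd σ i x (sumFin (λ y → blockInd σ j y (F x y))))

-- Let σ₊M be the image of a multiset M under the block map σ.  Taking images is additive
-- and preserves cardinality.  Let O*(i, j) be σ₊ of the union of the cells O(x, y) with
-- σ x = i and σ y = j.  Then every cell size, row count and column count of O* is the
-- corresponding quantity of O pushed forward along σ twice, i.e. the same for F, which is
-- F*.
module Submission where

open import Defs
open import Data.Nat using (ℕ; zero; suc; _+_)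
open import Data.Nat.Properties using (+-0-commutativeMonoid; +-identityʳ)
open import Data.Fin using (Fin; zero; suc; _≟_; punchIn)
open import Data.Fin.Properties using (punchInᵢ≢i)
open import Data.Product using (_,_; proj₁; proj₂)
open import Function using (_∘_)
open import Relation.Binary.PropositionalEquality
open import Relation.Nullary using (yes; no; contradiction)
open import Algebra.Properties.CommutativeMonoid.Sum +-0-commutativeMonoid
  using (sum; sum-cong-≗; sum-remove; sum-replicate-zero; ∑-comm)

open ≡-Reasoning

sumFin≡sum : ∀ {n} (f : Fin n → ℕ) → sumFin f ≡ sum f
sumFin≡sum {zero}  f = refl
sumFin≡sum {suc n} f = cong (f zero +_) (sumFin≡sum (f ∘ suc))

sumFin-cong : ∀ {n} {f g : Fin n → ℕ} → (∀ i → f i ≡ g i) → sumFin f ≡ sumFin g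
sumFin-cong {f = f} {g} f≗g = begin
  sumFin f ≡⟨ sumFin≡sum f ⟩
  sum f    ≡⟨ sum-cong-≗ f≗g ⟩
  sum g    ≡⟨ sumFin≡sum g ⟨
  sumFin g ∎

sumFin-zero : ∀ n → sumFin {n} (λ _ → 0) ≡ 0
sumFin-zero n = trans (sumFin≡sum {n} _) (sum-replicate-zero n)

sumFin-comm : ∀ {m n} (f : Fin m → Fin n → ℕ) →
              sumFin (λ i → sumFin (f i)) ≡ sumFin (λ j → sumFin (λ i → f i j))
sumFin-comm {m} {n} f = begin
  sumFin (λ i → sumFin (f i))          ≡⟨ sumFin-cong (sumFin≡sum ∘ f) ⟩
  sumFin (λ i → sum (f i))             ≡⟨ sumFin≡sum {m} _ ⟩
  sum (λ i → sum (f i))                ≡⟨ ∑-comm f ⟩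
  sum (λ j → sum (λ i → f i j))        ≡⟨ sumFin≡sum {n} _ ⟨
  sumFin (λ j → sum (λ i → f i j))     ≡⟨ sumFin-cong (λ j → sumFin≡sum (λ i → f i j)) ⟨
  sumFin (λ j → sumFin (λ i → f i j))  ∎

sumFin-single : ∀ {n} (a : Fin n) (f : Fin n → ℕ) →
                (∀ i → i ≢ a → f i ≡ 0) → sumFin f ≡ f a
sumFin-single {suc n} a f vanishes = begin
  sumFin f                   ≡⟨ sumFin≡sum f ⟩
  sum f                      ≡⟨ sum-remove f ⟩
  f a + sum (f ∘ punchIn a)  ≡⟨ cong (f a +_) (sum-cong-≗ (λ j → vanishes _ (punchInᵢ≢i a j))) ⟩
  f a + sum {n} (λ _ → 0)    ≡⟨ cong (f a +_) (sum-replicate-zero n) ⟩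
  f a + 0                    ≡⟨ +-identityʳ (f a) ⟩
  f a                        ∎

module _ {k k' : ℕ} (σ : Fin k → Fin k') where

  blockInd-self : ∀ x n → blockInd σ (σ x) x n ≡ n
  blockInd-self x n with σ x ≟ σ x
  ... | yes _    = refl
  ... | no σx≢σx = contradiction refl σx≢σx

  blockInd-other : ∀ i x n → i ≢ σ x → blockInd σ i x n ≡ 0
  blockInd-other i x n i≢σx with σ x ≟ i
  ... | yes σx≡i = contradiction (sym σx≡i) i≢σx
  ... | no _     = refl

  blockInd-zero : ∀ i x → blockInd σ i x 0 ≡ 0
  blockInd-zero i x with σ x ≟ i
  ... | yes _ = refl
  ... | no _  = refl

  sumFin-blockInd : ∀ x n → sumFin (λ i → blockInd σ i x n) ≡ n
  sumFin-blockInd x n =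
    trans (sumFin-single (σ x) _ (λ i → blockInd-other i x n)) (blockInd-self x n)

  blockInd-sumFin : ∀ {m} i x (f : Fin m → ℕ) →
                    blockInd σ i x (sumFin f) ≡ sumFin (λ y → blockInd σ i x (f y))
  blockInd-sumFin {m} i x f with σ x ≟ i
  ... | yes _ = refl
  ... | no _  = sym (sumFin-zero m)

  pushforward : Multiset k → Multiset k'
  pushforward M i = sumFin (λ x → blockInd σ i x (M x))

  pushforward-cong : ∀ {M N : Multiset k} → (∀ x → M x ≡ N x) →
                     ∀ i → pushforward M i ≡ pushforward N i
  pushforward-cong M≗N i = sumFin-cong (λ x → cong (blockInd σ i x) (M≗N x))

  ∣pushforward∣ : (M : Multiset k) → ∣ pushforward M ∣ₘ ≡ ∣ M ∣ₘ
  ∣pushforward∣ M = begin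
    sumFin (λ i → sumFin (λ x → blockInd σ i x (M x)))
      ≡⟨ sumFin-comm (λ i x → blockInd σ i x (M x)) ⟩
    sumFin (λ x → sumFin (λ i → blockInd σ i x (M x)))
      ≡⟨ sumFin-cong (λ x → sumFin-blockInd x (M x)) ⟩
    sumFin M
      ∎

  pushforward-sumFin : ∀ {m} (h : Fin k → Fin m → ℕ) i →
                       pushforward (λ x → sumFin (h x)) i ≡
                       sumFin (λ y → pushforward (λ x → h x y) i)
  pushforward-sumFin h i = begin
    sumFin (λ x → blockInd σ i x (sumFin (h x)))
      ≡⟨ sumFin-cong (λ x → blockInd-sumFin i x (h x)) ⟩
    sumFin (λ x → sumFin (λ y → blockInd σ i x (h x y)))
      ≡⟨ sumFin-comm (λ x y → blockInd σ i x (h x y)) ⟩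
    sumFin (λ y → sumFin (λ x → blockInd σ i x (h x y)))
      ∎

pushforward-blockInd : ∀ {k k' m m'} (σ : Fin k → Fin k') (τ : Fin m → Fin m')
                       (g : Multiset k) i j y →
                       pushforward σ (λ x → blockInd τ j y (g x)) i ≡
                       blockInd τ j y (pushforward σ g i)
pushforward-blockInd {k} σ τ g i j y with τ y ≟ j
... | yes _ = refl
... | no _  = trans (sumFin-cong (λ x → blockInd-zero σ i x)) (sumFin-zero k)

pushforward-comm : ∀ {k k' m m'} (σ : Fin k → Fin k') (τ : Fin m → Fin m')
                   (H : Fin k → Fin m → ℕ) i j →
                   pushforward σ (λ x → pushforward τ (H x) j) i ≡
                   pushforward τ (λ y → pushforward σ (λ x → H x y) i) j
pushforward-comm σ τ H i j = begin
  pushforward σ (λ x → pushforward τ (H x) j) i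
    ≡⟨ pushforward-sumFin σ (λ x y → blockInd τ j y (H x y)) i ⟩
  sumFin (λ y → pushforward σ (λ x → blockInd τ j y (H x y)) i)
    ≡⟨ sumFin-cong (λ y → pushforward-blockInd σ τ (λ x → H x y) i j y) ⟩
  pushforward τ (λ y → pushforward σ (λ x → H x y) i) j
    ∎

-- reduceFreq σ is pushforward₂ σ by definition.
pushforward₂ : ∀ {k k'} → (Fin k → Fin k') → FrequencyArray k → FrequencyArray k'
pushforward₂ σ A i j = pushforward σ (λ x → pushforward σ (A x) j) i

module _ {k k' : ℕ} (σ : Fin k → Fin k') where

  pushforward₂-cong : ∀ {A B : FrequencyArray k} → (∀ x y → A x y ≡ B x y) →
                      ∀ i j → pushforward₂ σ A i j ≡ pushforward₂ σ B i j
  pushforward₂-cong A≗B i j = pushforward-cong σ (λ x → pushforward-cong σ (A≗B x) j) i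

  pushforward₂-sumFin : ∀ {m} (h : Fin k → Fin k → Fin m → ℕ) i j →
                        pushforward₂ σ (λ x y → sumFin (h x y)) i j ≡
                        sumFin (λ l → pushforward₂ σ (λ x y → h x y l) i j)
  pushforward₂-sumFin h i j = begin
    pushforward σ (λ x → pushforward σ (λ y → sumFin (h x y)) j) i
      ≡⟨ pushforward-cong σ (λ x → pushforward-sumFin σ (h x) j) i ⟩
    pushforward σ (λ x → sumFin (λ l → pushforward σ (λ y → h x y l) j)) i
      ≡⟨ pushforward-sumFin σ (λ x l → pushforward σ (λ y → h x y l) j) i ⟩
    sumFin (λ l → pushforward₂ σ (λ x y → h x y l) i j)
      ∎

  rowSum-pushforward₂ : ∀ (A : FrequencyArray k) i →
                        sumFin (pushforward₂ σ A i) ≡ pushforward σ (λ x → sumFin (A x)) i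
  rowSum-pushforward₂ A i = begin
    sumFin (λ j → pushforward σ (λ x → pushforward σ (A x) j) i)
      ≡⟨ pushforward-sumFin σ (λ x j → pushforward σ (A x) j) i ⟨
    pushforward σ (λ x → ∣ pushforward σ (A x) ∣ₘ) i
      ≡⟨ pushforward-cong σ (λ x → ∣pushforward∣ σ (A x)) i ⟩
    pushforward σ (λ x → sumFin (A x)) i
      ∎

  colSum-pushforward₂ : ∀ (A : FrequencyArray k) j →
                        sumFin (λ i → pushforward₂ σ A i j) ≡
                        pushforward σ (λ y → sumFin (λ x → A x y)) j
  colSum-pushforward₂ A j = begin
    sumFin (λ i → pushforward σ (λ x → pushforward σ (A x) j) i)
      ≡⟨ ∣pushforward∣ σ (λ x → pushforward σ (A x) j) ⟩
    sumFin (λ x → pushforward σ (A x) j)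
      ≡⟨ pushforward-sumFin σ (λ y x → A x y) j ⟨
    pushforward σ (λ y → sumFin (λ x → A x y)) j
      ∎

reducedOutline : ∀ {k k'} → (Fin k → Fin k') → MultisetArray k → MultisetArray k'
reducedOutline σ O i j l = pushforward₂ σ (λ x y → pushforward σ (O x y) l) i j

module _ {k k' : ℕ} (σ : Fin k → Fin k') {F : FrequencyArray k} {O : MultisetArray k}
         (isOutline : IsOutlineArray F O) where

  private
    -- The cell-size condition carries a redundant symbol index; any one will do.
    cellSize : ∀ x y → ∣ O x y ∣ₘ ≡ F x y
    cellSize x y = proj₁ (isOutline x y x)

    rowCount≡ : ∀ x z → rowCount O x z ≡ F x z
    rowCount≡ x z = proj₁ (proj₂ (isOutline x x z))

    colCount≡ : ∀ y z → colCount O y z ≡ F z y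
    colCount≡ y z = proj₂ (proj₂ (isOutline y y z))

  reducedOutline-size : ∀ i j → ∣ reducedOutline σ O i j ∣ₘ ≡ reduceFreq σ F i j
  reducedOutline-size i j = begin
    sumFin (λ l → pushforward₂ σ (λ x y → pushforward σ (O x y) l) i j)
      ≡⟨ pushforward₂-sumFin σ (λ x y → pushforward σ (O x y)) i j ⟨
    pushforward₂ σ (λ x y → ∣ pushforward σ (O x y) ∣ₘ) i j
      ≡⟨ pushforward₂-cong σ (λ x y → trans (∣pushforward∣ σ (O x y)) (cellSize x y)) i j ⟩
    pushforward₂ σ F i j
      ∎

  reducedOutline-row : ∀ i l → rowCount (reducedOutline σ O) i l ≡ reduceFreq σ F i l
  reducedOutline-row i l = begin
    sumFin (pushforward₂ σ (λ x y → pushforward σ (O x y) l) i)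
      ≡⟨ rowSum-pushforward₂ σ (λ x y → pushforward σ (O x y) l) i ⟩
    pushforward σ (λ x → sumFin (λ y → pushforward σ (O x y) l)) i
      ≡⟨ pushforward-cong σ (λ x → pushforward-sumFin σ (λ z y → O x y z) l) i ⟨
    pushforward σ (λ x → pushforward σ (rowCount O x) l) i
      ≡⟨ pushforward-cong σ (λ x → pushforward-cong σ (rowCount≡ x) l) i ⟩
    pushforward₂ σ F i l
      ∎

  reducedOutline-col : ∀ j l → colCount (reducedOutline σ O) j l ≡ reduceFreq σ F l j
  reducedOutline-col j l = begin
    sumFin (λ i → pushforward₂ σ (λ x y → pushforward σ (O x y) l) i j)
      ≡⟨ colSum-pushforward₂ σ (λ x y → pushforward σ (O x y) l) j ⟩
    pushforward σ (λ y → sumFin (λ x → pushforward σ (O x y) l)) j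
      ≡⟨ pushforward-cong σ (λ y → pushforward-sumFin σ (λ z x → O x y z) l) j ⟨
    pushforward σ (λ y → pushforward σ (colCount O y) l) j
      ≡⟨ pushforward-cong σ (λ y → pushforward-cong σ (colCount≡ y) l) j ⟩
    pushforward σ (λ y → pushforward σ (λ z → F z y) l) j
      ≡⟨ pushforward-comm σ σ (λ y z → F z y) j l ⟩
    pushforward₂ σ F l j
      ∎

  reducedOutline-isOutline : IsOutlineArray (reduceFreq σ F) (reducedOutline σ O)
  reducedOutline-isOutline i j l =
    reducedOutline-size i j , reducedOutline-row i l , reducedOutline-col j l

mainTheorem19 : (k k' : ℕ) (F : FrequencyArray k) (σ : Fin k → Fin k')
    → HasOutlineArray F → IsPartitionMap σ → HasOutlineArray (reduceFreq σ F)
mainTheorem19 k k' F σ (O , isOutline) _ =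
  reducedOutline σ O , reducedOutline-isOutline σ isOutline
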